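{- Let $G=(V,E)$ be a 4-chordal graph, let $x\in V$, and let $uv\in E$ be an edge with $d_G(u,x)=d_G(v,x)$. Then $G$ contains a building $B(w|uv)$ as an isometric subgraph, for some vertex $w\in I(x,u)\cap I(x,v)$.
   Context: All graphs are finite, connected, unweighted, undirected, without loops or multiple edges; $d_G$ is the shortest-path metric. A graph is $k$-chordal if every induced cycle has length at most $k$. The interval $I(a,b)=\{z\in V: d_G(a,b)=d_G(a,z)+d_G(z,b)\}$. A subgraph $H$ of $G$ is isometric if $d_H(p,q)=d_G(p,q)$ for all vertices $p,q$ of $H$. A building $B(w|uv)$ is a chain of $m\ge 0$ 4-cycles ending with a triangle: it is the graph on vertices $w,u_0,\dots,u_m,v_0,\dots,v_m$ with edges $wu_0$, $wv_0$, $u_iv_i$ ($0\le i\le m$), $u_iu_{i+1}$ and $v_iv_{i+1}$ ($0\le i<m$), where $u=u_m$ and $v=v_m$ (for $m=0$ it is the triangle $w,u,v$). -}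

module Defs where

open import Data.Nat using (ℕ; zero; suc; _+_; _≤_)
open import Data.Fin using (Fin; toℕ; fromℕ)
open import Data.Bool using (Bool; true)
open import Data.Empty using (⊥)
open import Data.Product using (Σ; ∃; _×_; _,_)
open import Data.Sum using (_⊎_)
open import Relation.Binary.PropositionalEquality using (_≡_)
open import Function.Definitions using (Injective)

data Walk {V : Set} (E : V → V → Set) : V → V → ℕ → Set where
  nil  : ∀ {a} → Walk E a a 0
  cons : ∀ {a b c k} → E a b → Walk E b c k → Walk E a c (suc k)

Dist : {V : Set} (E : V → V → Set) → V → V → ℕ → Set
Dist E a b k = Walk E a b k × (∀ j → Walk E a b j → k ≤ j)

record Graph : Set where
  field
    n      : ℕ
    adj    : Fin n → Fin n → Bool
    sym    : ∀ a b → adj a b ≡ adj b a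
    irrefl : ∀ a → adj a a ≡ true → ⊥

module _ (G : Graph) where
  open Graph G

  V : Set
  V = Fin n

  E : V → V → Set
  E a b = adj a b ≡ true

  Connected : Set
  Connected = ∀ a b → ∃ λ k → Walk E a b k

  InInterval : V → V → V → Set
  InInterval a b z = ∃ λ p → ∃ λ q → ∃ λ r →
    Dist E a b p × Dist E a z q × Dist E z b r × p ≡ q + r

  CycAdj : (k : ℕ) → Fin k → Fin k → Set
  CycAdj k i j =
    suc (toℕ i) ≡ toℕ j ⊎ suc (toℕ j) ≡ toℕ i ⊎
    (toℕ i ≡ 0 × suc (toℕ j) ≡ k) ⊎ (toℕ j ≡ 0 × suc (toℕ i) ≡ k)

  IsInducedCycle : (k : ℕ) → (Fin k → V) → Set
  IsInducedCycle k c =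
    3 ≤ k × Injective _≡_ _≡_ c ×
    (∀ i j → (E (c i) (c j) → CycAdj k i j) × (CycAdj k i j → E (c i) (c j)))

  Chordal : ℕ → Set
  Chordal K = ∀ k (c : Fin k → V) → IsInducedCycle k c → k ≤ K

-- The building B(w|uv) with m+1 rungs u_i v_i (i = 0..m)

data BVert (m : ℕ) : Set where
  bw : BVert m
  bu : Fin (suc m) → BVert m
  bv : Fin (suc m) → BVert m

data BEdge (m : ℕ) : BVert m → BVert m → Set where
  w-u₀  : BEdge m bw (bu Fin.zero)
  u₀-w  : BEdge m (bu Fin.zero) bw
  w-v₀  : BEdge m bw (bv Fin.zero)
  v₀-w  : BEdge m (bv Fin.zero) bw
  u-v   : ∀ i → BEdge m (bu i) (bv i)
  v-u   : ∀ i → BEdge m (bv i) (bu i)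
  u-u⁺  : ∀ i j → suc (toℕ i) ≡ toℕ j → BEdge m (bu i) (bu j)
  u⁺-u  : ∀ i j → suc (toℕ i) ≡ toℕ j → BEdge m (bu j) (bu i)
  v-v⁺  : ∀ i j → suc (toℕ i) ≡ toℕ j → BEdge m (bv i) (bv j)
  v⁺-v  : ∀ i j → suc (toℕ i) ≡ toℕ j → BEdge m (bv j) (bv i)

-- G contains B(w|uv) (with w,u,v vertices of G, u = u_m, v = v_m) as an
-- isometric subgraph: an injective edge-preserving copy f of the building
-- whose (building) distances equal the distances in G.
HasIsometricBuilding : (G : Graph) → V G → V G → V G → Set
HasIsometricBuilding G w u v = ∃ λ m → Σ (BVert m → V G) λ f →
  Injective _≡_ _≡_ f ×
  f bw ≡ w × f (bu (fromℕ m)) ≡ u × f (bv (fromℕ m)) ≡ v ×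
  (∀ p q → BEdge m p q → E G (f p) (f q)) ×
  (∀ p q k → (Dist (BEdge m) p q k → Dist (E G) (f p) (f q) k) ×
             (Dist (E G) (f p) (f q) k → Dist (BEdge m) p q k))

-- Let w be a vertex of I(x,u) ∩ I(x,v) farthest from x, at distance t from u and v, and take geodesics
-- u = a₀ … a_t = w and v = b₀ … b_t = w. The choice of w rules out every edge a_i b_j except rungs a_r b_r
-- (and the final b_{t-1} w). If a₁b₁ were not an edge, the first rung a_r b_r (r ≥ 2), or failing that the
-- apex, would close an induced cycle of length at least 5. So a₁b₁ is an edge, and descending to it shows that
-- all a_r b_r are edges: the two geodesics span a building B(w|uv). It is isometric because every building
-- distance is a lower bound in G, again by the geodesic property of the sides and the choice of w.

module Submission where

open import Defs
open import Data.Bool using (true)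
import Data.Bool as Bool
open import Data.Empty using (⊥; ⊥-elim)
open import Data.Fin using (Fin; toℕ; fromℕ; fromℕ<)
import Data.Fin as Fin
open import Data.Fin.Properties using (toℕ-injective; toℕ<n; toℕ-fromℕ<; toℕ-fromℕ; any?)
open import Data.Nat using (ℕ; zero; suc; _+_; _∸_; _≤_; _<_; z≤n; s≤s; _≤?_; ∣_-_∣)
open import Data.Nat.Properties
open import Data.Product using (Σ; ∃; _×_; _,_; proj₁; proj₂)
open import Data.Sum using (_⊎_; inj₁; inj₂)
open import Function.Definitions using (Injective)
open import Relation.Nullary using (¬_; Dec; yes; no)
open import Relation.Nullary.Decidable using (_×-dec_)
open import Relation.Binary.PropositionalEquality

module Walks {V : Set} (E : V → V → Set) where

  infixr 5 _++_

  _++_ : ∀ {a b c k j} → Walk E a b k → Walk E b c j → Walk E a c (k + j)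
  nil ++ W′ = W′
  cons e W ++ W′ = cons e (W ++ W′)

  empty-walk : ∀ {a b} → a ≡ b → Walk E a b 0
  empty-walk refl = nil

  cast : ∀ {a b k j} → k ≡ j → Walk E a b k → Walk E a b j
  cast refl W = W

  snoc : ∀ {a b c k} → Walk E a b k → E b c → Walk E a c (suc k)
  snoc nil e = cons e nil
  snoc (cons e′ W) e = cons e′ (snoc W e)

  reverse : (∀ {a b} → E a b → E b a) → ∀ {a b k} → Walk E a b k → Walk E b a k
  reverse sym nil = nil
  reverse sym (cons e W) = snoc (reverse sym W) (sym e)

  vertex : ∀ {a b k} → Walk E a b k → ℕ → V
  vertex {a} nil _ = a
  vertex {a} (cons _ _) zero = a
  vertex (cons _ W) (suc i) = vertex W i

  vertex-zero : ∀ {a b k} (W : Walk E a b k) → vertex W 0 ≡ a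
  vertex-zero nil = refl
  vertex-zero (cons _ _) = refl

  vertex-length : ∀ {a b k} (W : Walk E a b k) → vertex W k ≡ b
  vertex-length nil = refl
  vertex-length (cons _ W) = vertex-length W

  take : ∀ {a b k} (W : Walk E a b k) i → i ≤ k → Walk E a (vertex W i) i
  take nil zero z≤n = nil
  take (cons _ _) zero z≤n = nil
  take (cons e W) (suc i) (s≤s i≤k) = cons e (take W i i≤k)

  drop : ∀ {a b k} (W : Walk E a b k) i → i ≤ k → Walk E (vertex W i) b (k ∸ i)
  drop nil zero z≤n = nil
  drop (cons e W) zero z≤n = cons e W
  drop (cons e W) (suc i) (s≤s i≤k) = drop W i i≤k

  step : ∀ {a b k} (W : Walk E a b k) i → i < k → E (vertex W i) (vertex W (suc i))
  step (cons e W) zero _ = subst (E _) (sym (vertex-zero W)) e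
  step (cons e W) (suc i) (s≤s i<k) = step W i i<k

  vertex-drop : ∀ {a b k} (W : Walk E a b k) i (i≤k : i ≤ k) r → vertex (drop W i i≤k) r ≡ vertex W (i + r)
  vertex-drop nil zero z≤n r = refl
  vertex-drop (cons e W) zero z≤n r = refl
  vertex-drop (cons e W) (suc i) (s≤s i≤k) r = vertex-drop W i i≤k r

  map : ∀ {V′ : Set} {E′ : V′ → V′ → Set} (f : V → V′) → (∀ {a b} → E a b → E′ (f a) (f b)) →
        ∀ {a b k} → Walk E a b k → Walk E′ (f a) (f b) k
  map f f-edge nil = nil
  map f f-edge (cons e W) = cons (f-edge e) (map f f-edge W)

  DistAtLeast : V → V → ℕ → Set
  DistAtLeast a b t = ∀ s → Walk E a b s → t ≤ s

  shortcut-bound : ∀ {x y p q T i s j} → DistAtLeast x y T → j ≤ T →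
    Walk E x p i → Walk E p q s → Walk E q y (T ∸ j) → j ≤ i + s
  shortcut-bound {T = T} {i} {s} {j} short j≤T X W Y =
    +-cancelʳ-≤ (T ∸ j) j (i + s) (subst₂ _≤_ (sym (m+[n∸m]≡n j≤T)) (sym (+-assoc i s (T ∸ j)))
      (short _ (X ++ W ++ Y)))

walk? : ∀ {n} {R : Fin n → Fin n → Set} → (∀ a b → Dec (R a b)) → ∀ k a b → Dec (Walk R a b k)
walk? R? zero a b with a Fin.≟ b
... | yes refl = yes nil
... | no a≢b = no λ { nil → a≢b refl }
walk? R? (suc k) a b with any? (λ c → R? a c ×-dec walk? R? k c b)
... | yes (c , e , W) = yes (cons e W)
... | no none = no λ { (cons e W) → none (_ , e , W) }

least-or-none : {P : ℕ → Set} → (∀ n → Dec (P n)) → ∀ k →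
  (∃ λ a → a < k × P a × (∀ b → b < a → ¬ P b)) ⊎ (∀ a → a < k → ¬ P a)
least-or-none P? zero = inj₂ λ _ ()
least-or-none {P} P? (suc k) with least-or-none P? k | P? k
... | inj₁ (a , a<k , Pa , least) | _ = inj₁ (a , m≤n⇒m≤1+n a<k , Pa , least)
... | inj₂ none | yes Pk = inj₁ (k , ≤-refl , Pk , none)
... | inj₂ none | no ¬Pk = inj₂ λ a a<1+k → case (m≤n⇒m<n∨m≡n (≤-pred a<1+k))
  where
    case : ∀ {a} → a < k ⊎ a ≡ k → ¬ P a
    case (inj₁ a<k) = none _ a<k
    case (inj₂ refl) = ¬Pk

within-one : ∀ {i j} → j ≤ i + 1 → i ≤ j + 1 → i ≡ j ⊎ suc i ≡ j ⊎ suc j ≡ i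
within-one {zero} {zero} _ _ = inj₁ refl
within-one {zero} {suc zero} _ _ = inj₂ (inj₁ refl)
within-one {suc zero} {zero} _ _ = inj₂ (inj₂ refl)
within-one {zero} {suc (suc _)} (s≤s ()) _
within-one {suc (suc _)} {zero} _ (s≤s ())
within-one {suc i} {suc j} (s≤s j≤i+1) (s≤s i≤j+1) with within-one j≤i+1 i≤j+1
... | inj₁ i≡j = inj₁ (cong suc i≡j)
... | inj₂ (inj₁ 1+i≡j) = inj₂ (inj₁ (cong suc 1+i≡j))
... | inj₂ (inj₂ 1+j≡i) = inj₂ (inj₂ (cong suc 1+j≡i))

+-tight : ∀ {m n p q} → m ≤ p → n ≤ q → m + n ≡ p + q → m ≡ p × n ≡ q
+-tight {m} {n} {p} {q} m≤p n≤q eq = m≡p , +-cancelˡ-≡ p n q (trans (cong (_+ n) (sym m≡p)) eq)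
  where
    m≡p : m ≡ p
    m≡p = ≤-antisym m≤p (+-cancelʳ-≤ q p m (subst (_≤ m + q) eq (+-monoʳ-≤ m n≤q)))

∣-∣≤ : ∀ {m n o} → n ≤ m + o → m ≤ n + o → ∣ m - n ∣ ≤ o
∣-∣≤ {m} {n} n≤m+o m≤n+o with ≤-total m n
... | inj₁ m≤n = subst (_≤ _) (sym (m≤n⇒∣m-n∣≡n∸m m≤n)) (m≤n+o⇒m∸n≤o n m n≤m+o)
... | inj₂ n≤m = subst (_≤ _) (sym (m≤n⇒∣n-m∣≡n∸m n≤m)) (m≤n+o⇒m∸n≤o m n m≤n+o)

∣-∣< : ∀ {m n o} → n ≤ m + o → m ≤ n + o → m + o ≢ n → n + o ≢ m → ∣ m - n ∣ < o
∣-∣< {m} {n} {o} n≤m+o m≤n+o m+o≢n n+o≢m = ≤∧≢⇒< (∣-∣≤ n≤m+o m≤n+o) tight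
  where
    tight : ∣ m - n ∣ ≢ o
    tight refl with ≤-total m n
    ... | inj₁ m≤n = m+o≢n (trans (cong (m +_) (m≤n⇒∣m-n∣≡n∸m m≤n)) (m+[n∸m]≡n m≤n))
    ... | inj₂ n≤m = n+o≢m (trans (cong (n +_) (m≤n⇒∣n-m∣≡n∸m n≤m)) (m+[n∸m]≡n n≤m))

∣∸-∸∣≡∣-∣ : ∀ {m d d′} → d ≤ m → d′ ≤ m → ∣ m ∸ d - m ∸ d′ ∣ ≡ ∣ d - d′ ∣
∣∸-∸∣≡∣-∣ {m} {d} {d′} d≤m d′≤m = begin
  ∣ m ∸ d - m ∸ d′ ∣                       ≡⟨ ∣m+n-m+o∣≡∣n-o∣ (d + d′) (m ∸ d) (m ∸ d′) ⟨
  ∣ d + d′ + (m ∸ d) - d + d′ + (m ∸ d′) ∣ ≡⟨ cong (λ n → ∣ n + (m ∸ d) - d + d′ + (m ∸ d′) ∣) (+-comm d d′) ⟩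
  ∣ d′ + d + (m ∸ d) - d + d′ + (m ∸ d′) ∣ ≡⟨ cong₂ ∣_-_∣ (regroup d d′ d≤m) (regroup d′ d d′≤m) ⟩
  ∣ m + d′ - m + d ∣                       ≡⟨ ∣m+n-m+o∣≡∣n-o∣ m d′ d ⟩
  ∣ d′ - d ∣                               ≡⟨ ∣-∣-comm d′ d ⟩
  ∣ d - d′ ∣                               ∎
  where
    open ≡-Reasoning
    regroup : ∀ e e′ → e ≤ m → e′ + e + (m ∸ e) ≡ m + e′
    regroup e e′ e≤m = begin
      e′ + e + (m ∸ e)   ≡⟨ +-assoc e′ e (m ∸ e) ⟩
      e′ + (e + (m ∸ e)) ≡⟨ cong (e′ +_) (m+[n∸m]≡n e≤m) ⟩
      e′ + m             ≡⟨ +-comm e′ m ⟩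
      m + e′             ∎

module Adjacency (G : Graph) where
  open Graph G renaming (sym to adj-sym)

  E-sym : ∀ {a b} → E G a b → E G b a
  E-sym {a} {b} e = trans (adj-sym b a) e

  E-irrefl : ∀ {a} → ¬ E G a a
  E-irrefl {a} = irrefl a

  E? : ∀ a b → Dec (E G a b)
  E? a b = adj a b Bool.≟ true

module InducedCycles (G : Graph) where
  open Adjacency G

  -- CycAdj, read on the positions toℕ i, toℕ j
  Consecutive : ℕ → ℕ → ℕ → Set
  Consecutive k i j = suc i ≡ j ⊎ suc j ≡ i ⊎ (i ≡ 0 × suc j ≡ k) ⊎ (j ≡ 0 × suc i ≡ k)

  Consecutive-sym : ∀ {k i j} → Consecutive k i j → Consecutive k j i
  Consecutive-sym (inj₁ c) = inj₂ (inj₁ c)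
  Consecutive-sym (inj₂ (inj₁ c)) = inj₁ c
  Consecutive-sym (inj₂ (inj₂ (inj₁ c))) = inj₂ (inj₂ (inj₂ c))
  Consecutive-sym (inj₂ (inj₂ (inj₂ c))) = inj₂ (inj₂ (inj₁ c))

  record InducedPath (p : ℕ) (a : ℕ → V G) : Set where
    field
      injective : ∀ {i j} → i ≤ p → j ≤ p → a i ≡ a j → i ≡ j
      adjacent : ∀ {i} → i < p → E G (a i) (a (suc i))
      adjacent⇒consecutive : ∀ {i j} → i ≤ p → j ≤ p → E G (a i) (a j) → suc i ≡ j ⊎ suc j ≡ i

  -- Two induced paths joined only by the edges a₀b₀ and a_p b_q; they close the induced cycle a₀ … a_p b_q … b₀.
  record PathCycle (p q : ℕ) (a b : ℕ → V G) : Set where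
    field
      pathᵃ : InducedPath p a
      pathᵇ : InducedPath q b
      disjoint : ∀ {i j} → i ≤ p → j ≤ q → a i ≢ b j
      cross : ∀ {i j} → i ≤ p → j ≤ q → E G (a i) (b j) → (i ≡ 0 × j ≡ 0) ⊎ (i ≡ p × j ≡ q)
      edge-start : E G (a 0) (b 0)
      edge-end : E G (a p) (b q)

  module _ {p q a b} (C : PathCycle p q a b) where
    open PathCycle C
    open InducedPath pathᵃ renaming (injective to injᵃ; adjacent to adjᵃ; adjacent⇒consecutive to consᵃ)
    open InducedPath pathᵇ renaming (injective to injᵇ; adjacent to adjᵇ; adjacent⇒consecutive to consᵇ)

    private
      L : ℕ
      L = suc (p + q)

    vertexAt : ∀ n → Dec (n ≤ p) → V G
    vertexAt n (yes _) = a n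
    vertexAt n (no _) = b (L ∸ n)

    data Position (n : ℕ) (c : V G) : Set where
      onA : n ≤ p → c ≡ a n → Position n c
      onB : ∀ {j} → p < n → j ≤ q → n + j ≡ L → c ≡ b j → Position n c

    position : ∀ {n} (d : Dec (n ≤ p)) → n ≤ L → Position n (vertexAt n d)
    position (yes n≤p) _ = onA n≤p refl
    position {n} (no n≰p) n≤L = onB (≰⇒> n≰p) j≤q (m+[n∸m]≡n n≤L) refl
      where
        j≤q : L ∸ n ≤ q
        j≤q = subst (L ∸ n ≤_) (m+n∸m≡n p q) (∸-monoʳ-≤ L (≰⇒> n≰p))

    cross⇒consecutive : ∀ {n n′ j} → n ≤ p → j ≤ q → n′ + j ≡ L → E G (a n) (b j) → Consecutive (suc L) n n′
    cross⇒consecutive h j≤q n′+j≡L e with cross h j≤q e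
    ... | inj₁ (refl , refl) = inj₂ (inj₂ (inj₁ (refl , cong suc (trans (sym (+-identityʳ _)) n′+j≡L))))
    ... | inj₂ (refl , refl) = inj₁ (sym (+-cancelʳ-≡ q _ _ n′+j≡L))

    edge⇒consecutive : ∀ {n n′ c c′} → Position n c → Position n′ c′ → E G c c′ → Consecutive (suc L) n n′
    edge⇒consecutive (onA h refl) (onA h′ refl) e with consᵃ h h′ e
    ... | inj₁ c = inj₁ c
    ... | inj₂ c = inj₂ (inj₁ c)
    edge⇒consecutive (onA h refl) (onB _ j≤q n′+j≡L refl) e = cross⇒consecutive h j≤q n′+j≡L e
    edge⇒consecutive (onB _ j≤q n+j≡L refl) (onA h refl) e =
      Consecutive-sym (cross⇒consecutive h j≤q n+j≡L (E-sym e))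
    edge⇒consecutive (onB _ j≤q n+j≡L refl) (onB _ j′≤q n′+j′≡L refl) e with consᵇ j≤q j′≤q e
    ... | inj₁ refl = inj₂ (inj₁ (sym (+-cancelʳ-≡ _ _ _ (trans n+j≡L (trans (sym n′+j′≡L) (+-suc _ _))))))
    ... | inj₂ refl = inj₁ (+-cancelʳ-≡ _ _ _ (trans (sym (+-suc _ _)) (trans n+j≡L (sym n′+j′≡L))))

    successor⇒edge : ∀ {n n′ c c′} → Position n c → Position n′ c′ → suc n ≡ n′ → E G c c′
    successor⇒edge (onA _ refl) (onA n<p refl) refl = adjᵃ n<p
    successor⇒edge (onA n≤p refl) (onB _ j≤q 1+n+j≡L refl) refl
      with refl , refl ← +-tight n≤p j≤q (suc-injective 1+n+j≡L) = edge-end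
    successor⇒edge (onB p<n _ _ _) (onA 1+n≤p _) refl = ⊥-elim (<-asym p<n 1+n≤p)
    successor⇒edge {n} (onB {j} _ j≤q n+j≡L refl) (onB {j′} _ _ 1+n+j′≡L refl) refl
      with refl ← +-cancelˡ-≡ n j (suc j′) (trans n+j≡L (trans (sym 1+n+j′≡L) (sym (+-suc _ _)))) =
      E-sym (adjᵇ j≤q)

    wrap⇒edge : ∀ {n n′ c c′} → Position n c → Position n′ c′ → n ≡ 0 → suc n′ ≡ suc L → E G c c′
    wrap⇒edge (onB p<n _ _ _) _ refl _ = ⊥-elim (n≮0 p<n)
    wrap⇒edge _ (onA n′≤p _) _ refl = ⊥-elim (<-irrefl refl (s≤s (≤-trans n′≤p (m≤m+n p q))))
    wrap⇒edge (onA _ refl) (onB _ _ L+j≡L refl) refl refl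
      with refl ← +-cancelˡ-≡ L _ 0 (trans L+j≡L (sym (+-identityʳ L))) = edge-start

    consecutive⇒edge : ∀ {n n′ c c′} → Position n c → Position n′ c′ → Consecutive (suc L) n n′ → E G c c′
    consecutive⇒edge s s′ (inj₁ c) = successor⇒edge s s′ c
    consecutive⇒edge s s′ (inj₂ (inj₁ c)) = E-sym (successor⇒edge s′ s c)
    consecutive⇒edge s s′ (inj₂ (inj₂ (inj₁ (c₀ , c₁)))) = wrap⇒edge s s′ c₀ c₁
    consecutive⇒edge s s′ (inj₂ (inj₂ (inj₂ (c₀ , c₁)))) = E-sym (wrap⇒edge s′ s c₀ c₁)

    position-unique : ∀ {n n′ c} → Position n c → Position n′ c → n ≡ n′
    position-unique (onA h refl) (onA h′ eq) = injᵃ h h′ eq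
    position-unique (onA h refl) (onB _ j≤q _ eq) = ⊥-elim (disjoint h j≤q eq)
    position-unique (onB _ j≤q _ refl) (onA h eq) = ⊥-elim (disjoint h j≤q (sym eq))
    position-unique (onB _ j≤q n+j≡L refl) (onB _ j′≤q n′+j′≡L eq) with refl ← injᵇ j≤q j′≤q eq =
      +-cancelʳ-≡ _ _ _ (trans n+j≡L (sym n′+j′≡L))

    cycle : Fin (suc L) → V G
    cycle i = vertexAt (toℕ i) (toℕ i ≤? p)

    position-of : ∀ i → Position (toℕ i) (cycle i)
    position-of i = position (toℕ i ≤? p) (≤-pred (toℕ<n i))

    isInducedCycle : 1 ≤ p + q → IsInducedCycle G (suc L) cycle
    isInducedCycle 1≤p+q = s≤s (s≤s 1≤p+q) ,
      (λ {i} {j} eq → toℕ-injective (position-unique (position-of i) (subst (Position _) (sym eq) (position-of j)))) ,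
      λ i j → edge⇒consecutive (position-of i) (position-of j) ,
              consecutive⇒edge (position-of i) (position-of j)

    length≤ : ∀ {k} → Chordal G k → 1 ≤ p + q → suc (suc (p + q)) ≤ k
    length≤ chordal 1≤p+q = chordal _ cycle (isInducedCycle 1≤p+q)

module Geodesics (G : Graph) where
  open Adjacency G
  open Walks (E G)
  open InducedCycles G

  geodesic-bound : ∀ {x y T i j s} → DistAtLeast x y T → (X : Walk (E G) x y T) → i ≤ T → j ≤ T →
    Walk (E G) (vertex X i) (vertex X j) s → j ≤ i + s
  geodesic-bound {i = i} short X i≤T j≤T W = shortcut-bound short j≤T (take X i i≤T) W (drop X _ j≤T)

  geodesic-inducedPath : ∀ {x y T p} → DistAtLeast x y T → (X : Walk (E G) x y T) → p ≤ T →
    InducedPath p (vertex X)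
  geodesic-inducedPath {T = T} {p} short X p≤T = record
    { injective = λ i≤p j≤p eq → ≤-antisym (bound-0 j≤p i≤p (sym eq)) (bound-0 i≤p j≤p eq)
    ; adjacent = λ i<p → step X _ (≤-trans i<p p≤T)
    ; adjacent⇒consecutive = consecutive
    }
    where
      bound : ∀ {i j s} → i ≤ p → j ≤ p → Walk (E G) (vertex X i) (vertex X j) s → j ≤ i + s
      bound i≤p j≤p = geodesic-bound short X (≤-trans i≤p p≤T) (≤-trans j≤p p≤T)

      bound-0 : ∀ {i j} → i ≤ p → j ≤ p → vertex X i ≡ vertex X j → j ≤ i
      bound-0 {i} i≤p j≤p eq = subst (_ ≤_) (+-identityʳ i) (bound i≤p j≤p (empty-walk eq))

      consecutive : ∀ {i j} → i ≤ p → j ≤ p → E G (vertex X i) (vertex X j) → suc i ≡ j ⊎ suc j ≡ i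
      consecutive i≤p j≤p e with within-one (bound i≤p j≤p (cons e nil)) (bound j≤p i≤p (cons (E-sym e) nil))
      ... | inj₁ refl = ⊥-elim (E-irrefl e)
      ... | inj₂ c = c

  -- d(u,w) = d(v,w) = t, and no vertex before w is reached from u and from v in the same s < t steps
  record Apex (u v w : V G) (t : ℕ) : Set where
    field
      toApexᵘ : Walk (E G) u w t
      toApexᵛ : Walk (E G) v w t
      shortestᵘ : DistAtLeast u w t
      shortestᵛ : DistAtLeast v w t
      lowest : ∀ {z a b} → Walk (E G) u z a → Walk (E G) v z a → Walk (E G) z w b → a + b ≡ t → t ≤ a

  Apex-swap : ∀ {u v w t} → Apex u v w t → Apex v u w t
  Apex-swap ap = record
    { toApexᵘ = toApexᵛ ; toApexᵛ = toApexᵘ ; shortestᵘ = shortestᵛ ; shortestᵛ = shortestᵘ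
    ; lowest = λ Wv Wu → lowest Wu Wv
    }
    where open Apex ap

  module ApexSides {u v w T} (ap : Apex u v w T) where
    open Apex ap

    a b : ℕ → V G
    a = vertex toApexᵘ
    b = vertex toApexᵛ

    rung-zero : E G u v → E G (a 0) (b 0)
    rung-zero = subst₂ (E G) (sym (vertex-zero toApexᵘ)) (sym (vertex-zero toApexᵛ))

    cross-bound : ∀ {i j s} → i ≤ T → j ≤ T → Walk (E G) (a i) (b j) s → j ≤ i + s
    cross-bound {i} i≤T j≤T W = shortcut-bound shortestᵘ j≤T (take toApexᵘ i i≤T) W (drop toApexᵛ _ j≤T)

    -- b_j is then reached from u and from v in j steps, so the minimality of the apex applies
    cross-tight : ∀ {i j s} → i ≤ T → j ≤ T → Walk (E G) (a i) (b j) s → i + s ≡ j → T ≤ j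
    cross-tight {i} i≤T j≤T W i+s≡j =
      lowest (cast i+s≡j (take toApexᵘ i i≤T ++ W)) (take toApexᵛ _ j≤T) (drop toApexᵛ _ j≤T) (m+[n∸m]≡n j≤T)

  module ApexCrossings {u v w T} (ap : Apex u v w T) where
    open ApexSides ap public
    private
      module Swapped = ApexSides (Apex-swap ap)

    cross-edge : ∀ {i j} → i ≤ T → j ≤ T → E G (a i) (b j) →
      i ≡ j ⊎ (suc i ≡ j × j ≡ T) ⊎ (suc j ≡ i × i ≡ T)
    cross-edge {i} {j} i≤T j≤T e
      with within-one (cross-bound i≤T j≤T (cons e nil)) (Swapped.cross-bound j≤T i≤T (cons (E-sym e) nil))
    ... | inj₁ i≡j = inj₁ i≡j
    ... | inj₂ (inj₁ 1+i≡j) =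
      inj₂ (inj₁ (1+i≡j , ≤-antisym j≤T (cross-tight i≤T j≤T (cons e nil) (trans (+-comm i 1) 1+i≡j))))
    ... | inj₂ (inj₂ 1+j≡i) =
      inj₂ (inj₂ (1+j≡i , ≤-antisym i≤T
        (Swapped.cross-tight j≤T i≤T (cons (E-sym e) nil) (trans (+-comm j 1) 1+j≡i))))

    common-vertex : ∀ {i j} → i ≤ T → j ≤ T → a i ≡ b j → j ≡ T
    common-vertex {i} {j} i≤T j≤T eq = ≤-antisym j≤T (cross-tight i≤T j≤T here i+0≡j)
      where
        here : Walk (E G) (a i) (b j) 0
        here = empty-walk eq
        i+0≡j : i + 0 ≡ j
        i+0≡j = trans (+-identityʳ i) (≤-antisym
          (subst (i ≤_) (+-identityʳ j) (Swapped.cross-bound j≤T i≤T (empty-walk (sym eq))))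
          (subst (j ≤_) (+-identityʳ i) (cross-bound i≤T j≤T here)))

  module FirstRung (chordal : Chordal G 4) {u v w t} (uv : E G u v) (ap : Apex u v w (suc (suc t))) where
    open Apex ap
    open ApexCrossings ap

    private
      T : ℕ
      T = suc (suc t)

    Rung : ℕ → Set
    Rung r = 1 ≤ r × E G (a r) (b r)

    -- a₀ … a_T b_{T-1} … b₀ has length 2T + 1 ≥ 5
    no-rung-impossible : (∀ r → r < T → ¬ Rung r) → ⊥
    no-rung-impossible none = too-long (length≤ pathCycle chordal (s≤s z≤n))
      where
        too-long : ¬ suc (suc (T + suc t)) ≤ 4
        too-long (s≤s (s≤s (s≤s (s≤s t+1+t≤0)))) = n≮0 (≤-trans (m≤n+m (suc t) t) t+1+t≤0)

        cross : ∀ {i j} → i ≤ T → j ≤ suc t → E G (a i) (b j) → (i ≡ 0 × j ≡ 0) ⊎ (i ≡ T × j ≡ suc t)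
        cross {i} i≤T j≤1+t e with cross-edge i≤T (m≤n⇒m≤1+n j≤1+t) e
        cross {zero} _ _ _ | inj₁ refl = inj₁ (refl , refl)
        cross {suc i} _ j≤1+t e | inj₁ refl = ⊥-elim (none (suc i) (s≤s j≤1+t) (s≤s z≤n , e))
        ... | inj₂ (inj₁ (_ , refl)) = ⊥-elim (1+n≰n j≤1+t)
        ... | inj₂ (inj₂ (1+j≡i , i≡T)) = inj₂ (i≡T , suc-injective (trans 1+j≡i i≡T))

        pathCycle : PathCycle T (suc t) a b
        pathCycle = record
          { pathᵃ = geodesic-inducedPath shortestᵘ toApexᵘ ≤-refl
          ; pathᵇ = geodesic-inducedPath shortestᵛ toApexᵛ (n≤1+n _)
          ; disjoint = λ i≤T j≤1+t eq → 1+n≰n (subst (_≤ suc t) (common-vertex i≤T (m≤n⇒m≤1+n j≤1+t) eq) j≤1+t)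
          ; cross = cross
          ; edge-start = rung-zero uv
          ; edge-end = E-sym (subst (E G _) (trans (vertex-length toApexᵛ) (sym (vertex-length toApexᵘ)))
                                (step toApexᵛ (suc t) ≤-refl))
          }

    -- a₀ … a_c b_c … b₀ has length 2c + 2 ≥ 6
    late-rung-impossible : ∀ {c} → c < T → 2 ≤ c → E G (a c) (b c) → (∀ r → r < c → ¬ Rung r) → ⊥
    late-rung-impossible {c} c<T 2≤c e below =
      too-long (length≤ pathCycle chordal (≤-trans (≤-trans (s≤s z≤n) 2≤c) (m≤m+n c c)))
      where
        too-long : ¬ suc (suc (c + c)) ≤ 4
        too-long (s≤s (s≤s c+c≤2)) = 4≰2 (≤-trans (+-mono-≤ 2≤c 2≤c) c+c≤2)
          where
            4≰2 : ¬ 4 ≤ 2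
            4≰2 (s≤s (s≤s ()))

        c≤T : c ≤ T
        c≤T = <⇒≤ c<T

        below-T : ∀ {i} → i ≤ c → i ≡ T → ⊥
        below-T i≤c refl = <-irrefl refl (≤-<-trans i≤c c<T)

        cross : ∀ {i j} → i ≤ c → j ≤ c → E G (a i) (b j) → (i ≡ 0 × j ≡ 0) ⊎ (i ≡ c × j ≡ c)
        cross {i} i≤c j≤c e′ with cross-edge (≤-trans i≤c c≤T) (≤-trans j≤c c≤T) e′
        cross {zero} _ _ _ | inj₁ refl = inj₁ (refl , refl)
        cross {suc i} i≤c _ e′ | inj₁ refl with m≤n⇒m<n∨m≡n i≤c
        ... | inj₁ i<c = ⊥-elim (below (suc i) i<c (s≤s z≤n , e′))
        ... | inj₂ i≡c = inj₂ (i≡c , i≡c)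
        cross i≤c j≤c e′ | inj₂ (inj₁ (_ , j≡T)) = ⊥-elim (below-T j≤c j≡T)
        cross i≤c j≤c e′ | inj₂ (inj₂ (_ , i≡T)) = ⊥-elim (below-T i≤c i≡T)

        pathCycle : PathCycle c c a b
        pathCycle = record
          { pathᵃ = geodesic-inducedPath shortestᵘ toApexᵘ c≤T
          ; pathᵇ = geodesic-inducedPath shortestᵛ toApexᵛ c≤T
          ; disjoint = λ i≤c j≤c eq → below-T j≤c (common-vertex (≤-trans i≤c c≤T) (≤-trans j≤c c≤T) eq)
          ; cross = cross
          ; edge-start = rung-zero uv
          ; edge-end = e
          }

    first-rung : E G (a 1) (b 1)
    first-rung with least-or-none (λ r → (1 ≤? r) ×-dec E? (a r) (b r)) T
    ... | inj₂ none = ⊥-elim (no-rung-impossible none)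
    ... | inj₁ (c , c<T , (1≤c , e) , below) with m≤n⇒m<n∨m≡n 1≤c
    ...   | inj₂ refl = e
    ...   | inj₁ 2≤c = ⊥-elim (late-rung-impossible c<T 2≤c e below)

  Apex-descend : ∀ {u v w t} (ap : Apex u v w (suc t)) → Apex (ApexSides.a ap 1) (ApexSides.b ap 1) w t
  Apex-descend ap = record
    { toApexᵘ = drop toApexᵘ 1 (s≤s z≤n)
    ; toApexᵛ = drop toApexᵛ 1 (s≤s z≤n)
    ; shortestᵘ = λ s W → ≤-pred (shortestᵘ (suc s) (take toApexᵘ 1 (s≤s z≤n) ++ W))
    ; shortestᵛ = λ s W → ≤-pred (shortestᵛ (suc s) (take toApexᵛ 1 (s≤s z≤n) ++ W))
    ; lowest = λ Wu Wv Wz eq →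
        ≤-pred (lowest (take toApexᵘ 1 (s≤s z≤n) ++ Wu) (take toApexᵛ 1 (s≤s z≤n) ++ Wv) Wz (cong suc eq))
    }
    where open Apex ap

  rungs : Chordal G 4 → ∀ {u v w t} → E G u v → (ap : Apex u v w t) →
    ∀ r → r < t → E G (ApexSides.a ap r) (ApexSides.b ap r)
  rungs chordal uv ap zero _ = ApexSides.rung-zero ap uv
  rungs chordal {t = suc (suc t)} uv ap (suc r) (s≤s r<1+t) =
    subst₂ (E G) (vertex-drop toApexᵘ 1 (s≤s z≤n) r) (vertex-drop toApexᵛ 1 (s≤s z≤n) r)
      (rungs chordal (FirstRung.first-rung chordal uv ap) (Apex-descend ap) r r<1+t)
    where open Apex ap

  module Levels {m : ℕ} where
    private
      level≤ : ∀ d → m ∸ d ≤ suc m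
      level≤ d = m≤n⇒m≤1+n (m∸n≤m m d)

    level-bound : ∀ {x y d d′ s} → DistAtLeast x y (suc m) → (X : Walk (E G) x y (suc m)) → d ≤ m → d′ ≤ m →
      Walk (E G) (vertex X (m ∸ d)) (vertex X (m ∸ d′)) s → ∣ d - d′ ∣ ≤ s
    level-bound {d = d} {d′} short X d≤m d′≤m W = subst (_≤ _) (∣∸-∸∣≡∣-∣ d≤m d′≤m)
      (∣-∣≤ (geodesic-bound short X (level≤ d) (level≤ d′) W)
            (geodesic-bound short X (level≤ d′) (level≤ d) (reverse E-sym W)))

    apex-bound : ∀ {x y d s} → DistAtLeast x y (suc m) → (X : Walk (E G) x y (suc m)) → d ≤ m →
      Walk (E G) y (vertex X (m ∸ d)) s → suc d ≤ s
    apex-bound {d = d} {s} short X d≤m W = +-cancelˡ-≤ (m ∸ d) (suc d) s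
      (subst (_≤ m ∸ d + s) level+depth (geodesic-bound short X (level≤ d) ≤-refl to-apex))
      where
        to-apex : Walk (E G) (vertex X (m ∸ d)) (vertex X (suc m)) s
        to-apex = subst (λ c → Walk (E G) (vertex X (m ∸ d)) c s) (sym (vertex-length X)) (reverse E-sym W)

        level+depth : suc m ≡ m ∸ d + suc d
        level+depth = trans (cong suc (sym (m∸n+n≡m d≤m))) (sym (+-suc (m ∸ d) d))

    cross-level-bound : ∀ {u v w d d′ s} (ap : Apex u v w (suc m)) → d ≤ m → d′ ≤ m →
      Walk (E G) (ApexSides.a ap (m ∸ d)) (ApexSides.b ap (m ∸ d′)) s → suc ∣ d - d′ ∣ ≤ s
    cross-level-bound {d = d} {d′} ap d≤m d′≤m W = subst (λ n → suc n ≤ _) (∣∸-∸∣≡∣-∣ d≤m d′≤m)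
      (∣-∣< (cross-bound (level≤ d) (level≤ d′) W) (Swapped.cross-bound (level≤ d′) (level≤ d) (reverse E-sym W))
            (λ eq → below-apex d′ (cross-tight (level≤ d) (level≤ d′) W eq))
            (λ eq → below-apex d (Swapped.cross-tight (level≤ d′) (level≤ d) (reverse E-sym W) eq)))
      where
        open ApexSides ap
        module Swapped = ApexSides (Apex-swap ap)
        below-apex : ∀ e → ¬ suc m ≤ m ∸ e
        below-apex e = ≤⇒≯ (m∸n≤m m e)

module Buildings (m : ℕ) where
  open Walks (BEdge m)

  BEdge-sym : ∀ {p q} → BEdge m p q → BEdge m q p
  BEdge-sym w-u₀ = u₀-w
  BEdge-sym u₀-w = w-u₀
  BEdge-sym w-v₀ = v₀-w
  BEdge-sym v₀-w = w-v₀
  BEdge-sym (u-v i) = v-u i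
  BEdge-sym (v-u i) = u-v i
  BEdge-sym (u-u⁺ i j eq) = u⁺-u i j eq
  BEdge-sym (u⁺-u i j eq) = u-u⁺ i j eq
  BEdge-sym (v-v⁺ i j eq) = v⁺-v i j eq
  BEdge-sym (v⁺-v i j eq) = v-v⁺ i j eq

  module Side (node : Fin (suc m) → BVert m)
              (next : ∀ i j → suc (toℕ i) ≡ toℕ j → BEdge m (node i) (node j)) where
    climb : ∀ d (i j : Fin (suc m)) → toℕ i + d ≡ toℕ j → Walk (BEdge m) (node i) (node j) d
    climb zero i j i+0≡j = empty-walk (cong node (toℕ-injective (trans (sym (+-identityʳ _)) i+0≡j)))
    climb (suc d) i j i+1+d≡j = cons (next i i′ (sym (toℕ-fromℕ< i′<))) (climb d i′ j i′+d≡j)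
      where
        1+i+d≡j : suc (toℕ i) + d ≡ toℕ j
        1+i+d≡j = trans (sym (+-suc (toℕ i) d)) i+1+d≡j

        i′< : suc (toℕ i) < suc m
        i′< = ≤-<-trans (subst (suc (toℕ i) ≤_) 1+i+d≡j (m≤m+n (suc (toℕ i)) d)) (toℕ<n j)

        i′ : Fin (suc m)
        i′ = fromℕ< i′<

        i′+d≡j : toℕ i′ + d ≡ toℕ j
        i′+d≡j = trans (cong (_+ d) (toℕ-fromℕ< i′<)) 1+i+d≡j

    along : ∀ i j → Walk (BEdge m) (node i) (node j) ∣ toℕ i - toℕ j ∣
    along i j with ≤-total (toℕ i) (toℕ j)
    ... | inj₁ i≤j = cast (sym (m≤n⇒∣m-n∣≡n∸m i≤j)) (climb _ i j (m+[n∸m]≡n i≤j))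
    ... | inj₂ j≤i = cast (sym (m≤n⇒∣n-m∣≡n∸m j≤i)) (reverse BEdge-sym (climb _ j i (m+[n∸m]≡n j≤i)))

  open Side bu u-u⁺ renaming (climb to climbᵘ; along to alongᵘ)
  open Side bv v-v⁺ renaming (climb to climbᵛ; along to alongᵛ)

  distance : BVert m → BVert m → ℕ
  distance bw bw = 0
  distance bw (bu j) = suc (toℕ j)
  distance bw (bv j) = suc (toℕ j)
  distance (bu i) bw = suc (toℕ i)
  distance (bv i) bw = suc (toℕ i)
  distance (bu i) (bu j) = ∣ toℕ i - toℕ j ∣
  distance (bv i) (bv j) = ∣ toℕ i - toℕ j ∣
  distance (bu i) (bv j) = suc ∣ toℕ i - toℕ j ∣
  distance (bv i) (bu j) = suc ∣ toℕ i - toℕ j ∣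

  shortest : ∀ p q → Walk (BEdge m) p q (distance p q)
  shortest bw bw = nil
  shortest bw (bu j) = cons w-u₀ (climbᵘ _ Fin.zero j refl)
  shortest bw (bv j) = cons w-v₀ (climbᵛ _ Fin.zero j refl)
  shortest (bu i) bw = reverse BEdge-sym (shortest bw (bu i))
  shortest (bv i) bw = reverse BEdge-sym (shortest bw (bv i))
  shortest (bu i) (bu j) = alongᵘ i j
  shortest (bv i) (bv j) = alongᵛ i j
  shortest (bu i) (bv j) = cons (u-v i) (alongᵛ i j)
  shortest (bv i) (bu j) = cons (v-u i) (alongᵘ i j)

  distance≤0⇒≡ : ∀ p q → distance p q ≤ 0 → p ≡ q
  distance≤0⇒≡ bw bw _ = refl
  distance≤0⇒≡ (bu i) (bu j) d≤0 = cong bu (toℕ-injective (∣m-n∣≡0⇒m≡n (n≤0⇒n≡0 d≤0)))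
  distance≤0⇒≡ (bv i) (bv j) d≤0 = cong bv (toℕ-injective (∣m-n∣≡0⇒m≡n (n≤0⇒n≡0 d≤0)))

dist-transfer : ∀ {A B : Set} {R : A → A → Set} {S : B → B → Set} {p q : A} {a b : B} {n : ℕ} →
  Walk R p q n → (∀ {k} → Walk R p q k → Walk S a b k) → Walks.DistAtLeast S a b n →
  ∀ k → (Dist R p q k → Dist S a b k) × (Dist S a b k → Dist R p q k)
dist-transfer {R = R} {S} {p} {q} {a} {b} {n} shortest transfer lower k = to , from
  where
    to : Dist R p q k → Dist S a b k
    to (W , least) = transfer W , λ j W′ → subst (_≤ j) (sym k≡n) (lower j W′)
      where
        k≡n : k ≡ n
        k≡n = ≤-antisym (least n shortest) (lower k (transfer W))

    from : Dist S a b k → Dist R p q k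
    from (W , least) =
      subst (Walk R p q) (sym k≡n) shortest , λ j W′ → subst (_≤ j) (sym k≡n) (lower j (transfer W′))
      where
        k≡n : k ≡ n
        k≡n = ≤-antisym (least n (transfer shortest)) (lower k W)

module IsometricBuilding (G : Graph) (chordal : Chordal G 4) {u v w m}
                         (uv : E G u v) (ap : Geodesics.Apex G u v w (suc m)) where
  open Adjacency G
  open Walks (E G)
  open Geodesics G
  open Apex ap
  open ApexSides ap
  open Levels {m}
  open Buildings m

  depth≤ : (i : Fin (suc m)) → toℕ i ≤ m
  depth≤ i = ≤-pred (toℕ<n i)

  embed : BVert m → V G
  embed bw = w
  embed (bu i) = a (m ∸ toℕ i)
  embed (bv i) = b (m ∸ toℕ i)

  roof : ∀ {x} (X : Walk (E G) x w (suc m)) → E G (vertex X m) w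
  roof X = subst (E G _) (vertex-length X) (step X m ≤-refl)

  side-edge : ∀ {x} (X : Walk (E G) x w (suc m)) (i j : Fin (suc m)) → suc (toℕ i) ≡ toℕ j →
    E G (vertex X (m ∸ toℕ i)) (vertex X (m ∸ toℕ j))
  side-edge X i j 1+i≡j =
    subst (λ r → E G (vertex X r) (vertex X (m ∸ toℕ j))) (sym level-step)
      (E-sym (step X (m ∸ toℕ j) (s≤s (m∸n≤m m (toℕ j)))))
    where
      level-step : m ∸ toℕ i ≡ suc (m ∸ toℕ j)
      level-step = trans (cong (suc m ∸_) 1+i≡j) (+-∸-assoc 1 (depth≤ j))

  rung : (i : Fin (suc m)) → E G (a (m ∸ toℕ i)) (b (m ∸ toℕ i))
  rung i = rungs chordal uv ap (m ∸ toℕ i) (s≤s (m∸n≤m m (toℕ i)))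

  embed-edge : ∀ {p q} → BEdge m p q → E G (embed p) (embed q)
  embed-edge w-u₀ = E-sym (roof toApexᵘ)
  embed-edge u₀-w = roof toApexᵘ
  embed-edge w-v₀ = E-sym (roof toApexᵛ)
  embed-edge v₀-w = roof toApexᵛ
  embed-edge (u-v i) = rung i
  embed-edge (v-u i) = E-sym (rung i)
  embed-edge (u-u⁺ i j 1+i≡j) = side-edge toApexᵘ i j 1+i≡j
  embed-edge (u⁺-u i j 1+i≡j) = E-sym (side-edge toApexᵘ i j 1+i≡j)
  embed-edge (v-v⁺ i j 1+i≡j) = side-edge toApexᵛ i j 1+i≡j
  embed-edge (v⁺-v i j 1+i≡j) = E-sym (side-edge toApexᵛ i j 1+i≡j)

  embed-lower : ∀ p q → DistAtLeast (embed p) (embed q) (distance p q)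
  embed-lower bw bw s W = z≤n
  embed-lower bw (bu j) s W = apex-bound shortestᵘ toApexᵘ (depth≤ j) W
  embed-lower bw (bv j) s W = apex-bound shortestᵛ toApexᵛ (depth≤ j) W
  embed-lower (bu i) bw s W = apex-bound shortestᵘ toApexᵘ (depth≤ i) (reverse E-sym W)
  embed-lower (bv i) bw s W = apex-bound shortestᵛ toApexᵛ (depth≤ i) (reverse E-sym W)
  embed-lower (bu i) (bu j) s W = level-bound shortestᵘ toApexᵘ (depth≤ i) (depth≤ j) W
  embed-lower (bv i) (bv j) s W = level-bound shortestᵛ toApexᵛ (depth≤ i) (depth≤ j) W
  embed-lower (bu i) (bv j) s W = cross-level-bound ap (depth≤ i) (depth≤ j) W
  embed-lower (bv i) (bu j) s W = subst (λ n → suc n ≤ s) (∣-∣-comm (toℕ j) (toℕ i))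
    (cross-level-bound ap (depth≤ j) (depth≤ i) (reverse E-sym W))

  embed-injective : Injective _≡_ _≡_ embed
  embed-injective {p} {q} eq = distance≤0⇒≡ p q (embed-lower p q 0 (empty-walk eq))

  embed-top : ∀ {x} (X : Walk (E G) x w (suc m)) → vertex X (m ∸ toℕ (fromℕ m)) ≡ x
  embed-top {x} X = begin
    vertex X (m ∸ toℕ (fromℕ m)) ≡⟨ cong (λ d → vertex X (m ∸ d)) (toℕ-fromℕ m) ⟩
    vertex X (m ∸ m)             ≡⟨ cong (vertex X) (n∸n≡0 m) ⟩
    vertex X 0                   ≡⟨ vertex-zero X ⟩
    x                            ∎
    where open ≡-Reasoning

  building : HasIsometricBuilding G w u v
  building = m , embed , embed-injective , refl , embed-top toApexᵘ , embed-top toApexᵛ , (λ _ _ → embed-edge) ,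
    λ p q → dist-transfer (shortest p q) (Walks.map (BEdge m) embed embed-edge) (embed-lower p q)

module _ (G : Graph) where
  open Adjacency G
  open Walks (E G)
  open Geodesics G

  isometric-building : ∀ {u v w t} → Chordal G 4 → E G u v → Apex u v w t → HasIsometricBuilding G w u v
  isometric-building {t = suc m} chordal uv ap = IsometricBuilding.building G chordal uv ap
  isometric-building {t = zero} chordal uv ap with Apex.toApexᵘ ap | Apex.toApexᵛ ap
  ... | nil | nil = ⊥-elim (E-irrefl uv)

  Dist-sym : ∀ {a b k} → Dist (E G) a b k → Dist (E G) b a k
  Dist-sym (W , least) = reverse E-sym W , λ j W′ → least j (reverse E-sym W′)

  ∈-interval : ∀ {x u w k t} → Dist (E G) u x k → Dist (E G) u w t → Walk (E G) w x (k ∸ t) → t ≤ k →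
    InInterval G x u w
  ∈-interval {k = k} {t} du@(_ , u-least) dw@(u→w , _) w→x t≤k =
    k , k ∸ t , t , Dist-sym du ,
    (reverse E-sym w→x , λ j W → m≤n+o⇒m∸n≤o k t (u-least _ (u→w ++ reverse E-sym W))) ,
    Dist-sym dw , sym (m∸n+n≡m t≤k)

  module _ {u v x k} (du : Dist (E G) u x k) (dv : Dist (E G) v x k) where
    private
      Meeting : ℕ → Set
      Meeting t = ∃ λ z → Walk (E G) u z t × Walk (E G) v z t × Walk (E G) z x (k ∸ t)

      meeting? : ∀ t → Dec (Meeting t)
      meeting? t = any? λ z → walk? E? t u z ×-dec (walk? E? t v z ×-dec walk? E? (k ∸ t) z x)

    -- w is the vertex of I(x,u) ∩ I(x,v) farthest from x
    apex-exists : ∃ λ t → ∃ λ w → Apex u v w t × t ≤ k × Walk (E G) w x (k ∸ t)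
    apex-exists with least-or-none meeting? (suc k)
    ... | inj₂ none = ⊥-elim (none k ≤-refl (x , proj₁ du , proj₁ dv , cast (sym (n∸n≡0 k)) nil))
    ... | inj₁ (t , t<1+k , (w , u→w , v→w , w→x) , earlier) = t , w , apex , t≤k , w→x
      where
        t≤k : t ≤ k
        t≤k = ≤-pred t<1+k

        apex : Apex u v w t
        apex = record
          { toApexᵘ = u→w
          ; toApexᵛ = v→w
          ; shortestᵘ = λ s W → shortcut-bound (proj₂ du) t≤k nil W w→x
          ; shortestᵛ = λ s W → shortcut-bound (proj₂ dv) t≤k nil W w→x
          ; lowest = λ {z} {a} {b} u→z v→z z→w a+b≡t → ≮⇒≥ λ a<t →
              earlier a a<t (z , u→z , v→z , cast (remaining a+b≡t) (z→w ++ w→x))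
          }
          where
            remaining : ∀ {a b} → a + b ≡ t → b + (k ∸ t) ≡ k ∸ a
            remaining {a} {b} a+b≡t = begin
              b + (k ∸ t)             ≡⟨ m+n∸m≡n a _ ⟨
              a + (b + (k ∸ t)) ∸ a   ≡⟨ cong (_∸ a) (+-assoc a b (k ∸ t)) ⟨
              a + b + (k ∸ t) ∸ a     ≡⟨ cong (λ n → n + (k ∸ t) ∸ a) a+b≡t ⟩
              t + (k ∸ t) ∸ a         ≡⟨ cong (_∸ a) (m+[n∸m]≡n t≤k) ⟩
              k ∸ a                   ∎
              where open ≡-Reasoning

lemma2 : (G : Graph) → Connected G → Chordal G 4 →
    (x u v : V G) → E G u v → (∃ λ k → Dist (E G) u x k × Dist (E G) v x k) →
    Σ (V G) λ w → InInterval G x u w × InInterval G x v w × HasIsometricBuilding G w u v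
lemma2 G _ chordal x u v uv (k , du , dv) with apex-exists G du dv
... | t , w , ap , t≤k , w→x =
  w , ∈-interval G du (toApexᵘ , shortestᵘ) w→x t≤k , ∈-interval G dv (toApexᵛ , shortestᵛ) w→x t≤k ,
  isometric-building G chordal uv ap
  where open Geodesics.Apex ap
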